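{- For each pair of integers $m,n$ with $1<m<n$, if $m$ and $n$ are both even or both odd, then $TAUT_{NM_n}\forall\subsetneq TAUT_{NM_m}\forall$.
   Context: $NM_k$ ($k\ge2$) is the $k$-element NM-chain, realized on $\{0,\frac1{k-1},\dots,\frac{k-2}{k-1},1\}$ with the real order, $n(x)=1-x$, $x*y=0$ if $x\le1-y$ and $\min(x,y)$ otherwise, $x\Rightarrow y=1$ if $x\le y$ and $\max(1-x,y)$ otherwise. First-order formulas over a fixed countable predicate language use $\&,\land,\to,\bot,\forall,\exists$ interpreted by $*,\min,\Rightarrow,0$, infimum, supremum. $TAUT_{\mathcal{A}}\forall$ is the set of formulas taking value $1$ under every evaluation in every $\mathcal{A}$-model (nonempty domain, maps $M^k\to A$ for $k$-ary predicates, elements for constants). $\subsetneq$ is strict inclusion. -}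

module Defs where

open import Data.Nat as ℕ using (ℕ; zero; suc; _≤ᵇ_)
open import Data.Fin using (Fin; toℕ; fromℕ; opposite) renaming (zero to fzero)
open import Data.Bool using (if_then_else_)
open import Data.Vec using (Vec; map)
open import Data.Product using (Σ; _×_; _,_)
open import Data.Unit using (⊤)
open import Level using (Lift)
open import Relation.Binary.PropositionalEquality using (_≡_)
open import Relation.Nullary using (¬_)

-- The NM-chain NM_k for k = suc j, realised on Fin (suc j):
-- element i stands for the real number i/(k-1).

module NM (j : ℕ) where
  Carrier : Set
  Carrier = Fin (suc j)

  _≤_ : Carrier → Carrier → Set
  x ≤ y = toℕ x ℕ.≤ toℕ y

  top bot : Carrier
  top = fromℕ j
  bot = fzero

  neg : Carrier → Carrier
  neg = opposite

  min max : Carrier → Carrier → Carrier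
  min x y = if toℕ x ≤ᵇ toℕ y then x else y
  max x y = if toℕ x ≤ᵇ toℕ y then y else x

  _⊛_ : Carrier → Carrier → Carrier
  x ⊛ y = if toℕ x ≤ᵇ toℕ (neg y) then bot else min x y

  _⇛_ : Carrier → Carrier → Carrier
  x ⇛ y = if toℕ x ≤ᵇ toℕ y then top else max (neg x) y

data Term : Set where
  var  : ℕ → Term
  cnst : ℕ → Term

data Fm : Set where
  pred   : (k i : ℕ) → Vec Term k → Fm
  _&ᶠ_   : Fm → Fm → Fm
  _∧ᶠ_   : Fm → Fm → Fm
  _→ᶠ_   : Fm → Fm → Fm
  ⊥ᶠ     : Fm
  ∀ᶠ     : ℕ → Fm → Fm
  ∃ᶠ     : ℕ → Fm → Fm

module Sem (j : ℕ) where
  open NM j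

  record Model : Set₁ where
    field
      Dom       : Set
      inhabitant : Dom
      predI     : (k i : ℕ) → Vec Dom k → Carrier
      constI    : ℕ → Dom

  module _ (M : Model) where
    open Model M

    Eval : Set
    Eval = ℕ → Dom

    update : Eval → ℕ → Dom → Eval
    update e x d y = if y ℕ.≡ᵇ x then d else e y

    term : Eval → Term → Dom
    term e (var x)  = e x
    term e (cnst c) = constI c

    -- Quantifiers are interpreted as infimum / supremum (given relationally,
    -- since an arbitrary domain admits no computable inf/sup constructively).
    Val : Fm → Eval → Carrier → Set
    Val (pred k i ts) e v = v ≡ predI k i (map (term e) ts)
    Val (φ &ᶠ ψ) e v = Σ Carrier λ a → Σ Carrier λ b → Val φ e a × Val ψ e b × v ≡ a ⊛ b
    Val (φ ∧ᶠ ψ) e v = Σ Carrier λ a → Σ Carrier λ b → Val φ e a × Val ψ e b × v ≡ min a b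
    Val (φ →ᶠ ψ) e v = Σ Carrier λ a → Σ Carrier λ b → Val φ e a × Val ψ e b × v ≡ a ⇛ b
    Val ⊥ᶠ e v = v ≡ bot
    Val (∀ᶠ x φ) e v =
      ((d : Dom) (w : Carrier) → Val φ (update e x d) w → v ≤ w) ×
      ((u : Carrier) → ((d : Dom) (w : Carrier) → Val φ (update e x d) w → u ≤ w) → u ≤ v)
    Val (∃ᶠ x φ) e v =
      ((d : Dom) (w : Carrier) → Val φ (update e x d) w → w ≤ v) ×
      ((u : Carrier) → ((d : Dom) (w : Carrier) → Val φ (update e x d) w → w ≤ u) → v ≤ u)

  Taut : Fm → Set₁
  Taut φ = (M : Model) (e : Eval M) (v : Carrier) → Val M φ e v → v ≡ top

-- TAUT_{NM_k}∀ for k ≥ 1 (k = 0 never occurs in the theorem).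
TAUT : ℕ → Fm → Set₁
TAUT zero    φ = Lift _ ⊤
TAUT (suc j) φ = Sem.Taut j φ

_⊂_ : (Fm → Set₁) → (Fm → Set₁) → Set₁
S ⊂ T = ((φ : Fm) → S φ → T φ) × Σ Fm λ φ → T φ × ¬ S φ

module Submission where

-- If m ≡ n mod 2, the map 0 ↦ 0, x ↦ x + (n-m)/2 (0 < x < m-1), m-1 ↦ n-1 embeds NM_m
-- into NM_n preserving n, *, ⇒ and, having Galois adjoints on both sides, all infima
-- and suprema; so every NM_m-model is (up to this embedding) an NM_n-model and
-- TAUT_{NM_n}∀ ⊆ TAUT_{NM_m}∀.  The inclusion is strict: the disjunction
-- (p₀ → p₁) ∨ … ∨ (p_{m-1} → p_m) fails only if p₀ > p₁ > … > p_m, which needs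
-- m + 1 truth values, so it is an NM_m-tautology but not an NM_n-tautology.

open import Defs
open import Data.Bool using (true; false; if_then_else_)
open import Data.Bool.Properties using (if-float; if-eta)
open import Data.Empty using (⊥-elim)
open import Data.Fin using (Fin; zero; suc; toℕ; fromℕ; fromℕ<; opposite)
open import Data.Fin.Properties
  using (≤-antisym; ≤fromℕ; toℕ-injective; toℕ-fromℕ; toℕ-fromℕ<; toℕ≤pred[n];
         opposite-prop; opposite-involutive)
open import Data.Nat as ℕ using (ℕ; zero; suc; z≤n; s≤s; _<_; _≤ᵇ_; _+_; _*_; _∸_; _%_; _/_)
open import Data.Nat.DivMod using (m≡m%n+[m/n]*n; /-monoˡ-≤)
open import Data.Nat.Properties
  using (≤-refl; ≤-trans; ≤-total; ≤-reflexive; _≤?_; ≤ᵇ-reflects-≤; ≤ᵇ⇒≤; ≤⇒≤ᵇ; <⇒≱; ≰⇒>; ≮⇒≥; <⇒≤;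
         ∸-monoʳ-≤; ∸-monoʳ-<; +-mono-≤; +-identityʳ; +-suc; m≤m+n; m∸n≤m; n<1+n; m≤n⇒m<n∨m≡n;
         n∸n≡0; m<n⇒0<n∸m; m+[n∸m]≡n; m+n∸m≡n)
open import Data.Nat.Tactic.RingSolver using (solve-∀)
open import Data.Product using (Σ; ∃-syntax; _×_; _,_; proj₁; proj₂)
open import Data.Unit using (⊤; tt)
open import Data.Vec using ([]; map)
open import Data.Vec.Properties using (map-cong)
open import Data.Sum using (_⊎_; inj₁; inj₂)
open import Function using (_∘_)
open import Relation.Binary.PropositionalEquality
open import Relation.Nullary using (¬_; yes; no)
open import Relation.Nullary.Reflects using (ofʸ; ofⁿ; det; fromEquivalence)
open import Relation.Unary using (Decidable)

least : ∀ {n} (P : Fin n → Set) → Decidable P → ∀ {w} → P w →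
        Σ (Fin n) λ k → P k × (∀ y → P y → toℕ k ℕ.≤ toℕ y)
least P P? {zero} P0 = zero , P0 , λ _ _ → z≤n
least P P? {suc w} Pw with P? zero
... | yes P0 = zero , P0 , λ _ _ → z≤n
... | no ¬P0 with least (P ∘ suc) (P? ∘ suc) Pw
...   | k , Pk , k-least = suc k , Pk , λ { zero P0 → ⊥-elim (¬P0 P0) ; (suc y) Py → s≤s (k-least y Py) }

opposite-antitone : ∀ {n} {x y : Fin n} → toℕ x ℕ.≤ toℕ y → toℕ (opposite y) ℕ.≤ toℕ (opposite x)
opposite-antitone {n} {x} {y} x≤y =
  subst₂ ℕ._≤_ (sym (opposite-prop y)) (sym (opposite-prop x)) (∸-monoʳ-≤ n (s≤s x≤y))

module NMChain (j : ℕ) where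
  open NM j public

  ≤top : ∀ x → x ≤ top
  ≤top = ≤fromℕ

  top≤⇒≡top : ∀ {x} → top ≤ x → x ≡ top
  top≤⇒≡top {x} top≤x = ≤-antisym (≤top x) top≤x

  neg-top : neg top ≡ bot
  neg-top = opposite-involutive zero

  neg≡top⇒≡bot : ∀ {x} → neg x ≡ top → x ≡ bot
  neg≡top⇒≡bot {x} eq = trans (sym (opposite-involutive x)) (trans (cong neg eq) neg-top)

  min-idem : ∀ x → min x x ≡ x
  min-idem x = if-eta (toℕ x ≤ᵇ toℕ x)

  min≡top⇒ : ∀ {x y} → min x y ≡ top → x ≡ top × y ≡ top
  min≡top⇒ {x} {y} eq with toℕ x ≤ᵇ toℕ y | ≤ᵇ-reflects-≤ (toℕ x) (toℕ y)
  ... | true  | ofʸ x≤y = eq , top≤⇒≡top (subst (_≤ y) eq x≤y)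
  ... | false | ofⁿ x≰y = ⊥-elim (x≰y (subst (x ≤_) (sym eq) (≤top x))) , eq

  max≡top⇒ : ∀ {x y} → max x y ≡ top → x ≡ top ⊎ y ≡ top
  max≡top⇒ {x} {y} eq with toℕ x ≤ᵇ toℕ y
  ... | true  = inj₂ eq
  ... | false = inj₁ eq

  ≤⇒⇛≡top : ∀ {x y} → x ≤ y → x ⇛ y ≡ top
  ≤⇒⇛≡top {x} {y} x≤y with toℕ x ≤ᵇ toℕ y | ≤ᵇ-reflects-≤ (toℕ x) (toℕ y)
  ... | true  | _       = refl
  ... | false | ofⁿ x≰y = ⊥-elim (x≰y x≤y)

  ⇛≡top⇒≤ : ∀ {x y} → x ⇛ y ≡ top → x ≤ y
  ⇛≡top⇒≤ {x} {y} eq with toℕ x ≤ᵇ toℕ y | ≤ᵇ-reflects-≤ (toℕ x) (toℕ y)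
  ... | true  | ofʸ x≤y = x≤y
  ... | false | _ with max≡top⇒ eq
  ...   | inj₁ negx≡top = subst (_≤ y) (sym (neg≡top⇒≡bot negx≡top)) z≤n
  ...   | inj₂ y≡top  = subst (x ≤_) (sym y≡top) (≤top x)

  ⇛≡top⊎> : ∀ x y → x ⇛ y ≡ top ⊎ toℕ y < toℕ x
  ⇛≡top⊎> x y with toℕ x ≤? toℕ y
  ... | yes x≤y = inj₁ (≤⇒⇛≡top x≤y)
  ... | no x≰y  = inj₂ (≰⇒> x≰y)

  ⇛-refl : ∀ x → x ⇛ x ≡ top
  ⇛-refl x = ≤⇒⇛≡top {x} ≤-refl

  ⇛top : ∀ x → x ⇛ top ≡ top
  ⇛top x = ≤⇒⇛≡top (≤top x)

  top⇛ : ∀ y → top ⇛ y ≡ y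
  top⇛ y with toℕ top ≤ᵇ toℕ y | ≤ᵇ-reflects-≤ (toℕ top) (toℕ y)
  ... | true  | ofʸ top≤y = sym (top≤⇒≡top top≤y)
  ... | false | _         = cong (λ z → max z y) neg-top

  _∨_ : Carrier → Carrier → Carrier
  x ∨ y = min ((x ⇛ y) ⇛ y) ((y ⇛ x) ⇛ x)

  ∨-topˡ : ∀ y → top ∨ y ≡ top
  ∨-topˡ y = trans (cong₂ min (trans (cong (_⇛ y) (top⇛ y)) (⇛-refl y)) (⇛top (y ⇛ top)))
                   (min-idem top)

  ∨-topʳ : ∀ x → x ∨ top ≡ top
  ∨-topʳ x = trans (cong₂ min (⇛top (x ⇛ top)) (trans (cong (_⇛ x) (top⇛ x)) (⇛-refl x)))
                   (min-idem top)

  ∨≡top⇒ : ∀ {x y} → x ∨ y ≡ top → x ≡ top ⊎ y ≡ top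
  ∨≡top⇒ {x} {y} eq with min≡top⇒ eq | ≤-total (toℕ x) (toℕ y)
  ... | x⇛y⇛y , _ | inj₁ x≤y = inj₂ (top≤⇒≡top (subst (_≤ y) (≤⇒⇛≡top x≤y) (⇛≡top⇒≤ x⇛y⇛y)))
  ... | _ , y⇛x⇛x | inj₂ y≤x = inj₁ (top≤⇒≡top (subst (_≤ x) (≤⇒⇛≡top y≤x) (⇛≡top⇒≤ y⇛x⇛x)))

  -- The clauses of Val are literally these shapes, so connectives and quantifiers
  -- can be handled once and for all below.
  Apply₂ : (Carrier → Carrier → Carrier) → (Carrier → Set) → (Carrier → Set) → Carrier → Set
  Apply₂ _∙_ V W v = Σ Carrier λ a → Σ Carrier λ b → V a × W b × v ≡ a ∙ b

  module _ {D : Set} (V : D → Carrier → Set) where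
    LowerBound UpperBound IsInf IsSup : Carrier → Set
    LowerBound u = (d : D) (w : Carrier) → V d w → u ≤ w
    UpperBound u = (d : D) (w : Carrier) → V d w → w ≤ u
    IsInf v = LowerBound v × ((u : Carrier) → LowerBound u → u ≤ v)
    IsSup v = UpperBound v × ((u : Carrier) → UpperBound u → v ≤ u)

  Unique : (Carrier → Set) → Set
  Unique V = ∀ {v w} → V v → V w → v ≡ w

  apply₂-unique : ∀ _∙_ {V W} → Unique V → Unique W → Unique (Apply₂ _∙_ V W)
  apply₂-unique _∙_ V! W! (a , b , Va , Wb , refl) (a′ , b′ , Va′ , Wb′ , refl) =
    cong₂ _∙_ (V! Va Va′) (W! Wb Wb′)

  inf-unique : ∀ {D} (V : D → Carrier → Set) → Unique (IsInf V)
  inf-unique V (lb , glb) (lb′ , glb′) = ≤-antisym (glb′ _ lb) (glb _ lb′)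

  sup-unique : ∀ {D} (V : D → Carrier → Set) → Unique (IsSup V)
  sup-unique V (ub , lub) (ub′ , lub′) = ≤-antisym (lub _ ub′) (lub′ _ ub)

  open Sem j public

  val-unique : ∀ (M : Model) φ e → Unique (Val M φ e)
  val-unique M (pred k i ts) e p q = trans p (sym q)
  val-unique M (φ &ᶠ ψ) e = apply₂-unique _⊛_ (val-unique M φ e) (val-unique M ψ e)
  val-unique M (φ ∧ᶠ ψ) e = apply₂-unique min (val-unique M φ e) (val-unique M ψ e)
  val-unique M (φ →ᶠ ψ) e = apply₂-unique _⇛_ (val-unique M φ e) (val-unique M ψ e)
  val-unique M ⊥ᶠ e p q = trans p (sym q)
  val-unique M (∀ᶠ x φ) e = inf-unique (λ d → Val M φ (update M e x d))
  val-unique M (∃ᶠ x φ) e = sup-unique (λ d → Val M φ (update M e x d))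

module Embedding {a b : ℕ} (f : Fin (suc a) → Fin (suc b))
  (f-mono    : ∀ {x y} → toℕ x ℕ.≤ toℕ y → toℕ (f x) ℕ.≤ toℕ (f y))
  (f-reflect : ∀ {x y} → toℕ (f x) ℕ.≤ toℕ (f y) → toℕ x ℕ.≤ toℕ y)
  (f-top     : f (fromℕ a) ≡ fromℕ b)
  (f-neg     : ∀ x → f (opposite x) ≡ opposite (f x))
  where

  module A = NMChain a
  module B = NMChain b
  open Data.Fin using (_≤_)

  f-injective : ∀ {x y} → f x ≡ f y → x ≡ y
  f-injective eq =
    ≤-antisym (f-reflect (≤-reflexive (cong toℕ eq))) (f-reflect (≤-reflexive (cong toℕ (sym eq))))

  f-bot : f zero ≡ zero
  f-bot = begin
    f zero                     ≡⟨ cong f (sym (opposite-involutive zero)) ⟩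
    f (opposite (fromℕ a))     ≡⟨ f-neg (fromℕ a) ⟩
    opposite (f (fromℕ a))     ≡⟨ cong opposite f-top ⟩
    opposite (fromℕ b)         ≡⟨ opposite-involutive zero ⟩
    zero                       ∎
    where open ≡-Reasoning

  f-≤ᵇ : ∀ x y → (toℕ (f x) ≤ᵇ toℕ (f y)) ≡ (toℕ x ≤ᵇ toℕ y)
  f-≤ᵇ x y = det (≤ᵇ-reflects-≤ (toℕ (f x)) (toℕ (f y)))
                 (fromEquivalence (f-mono ∘ ≤ᵇ⇒≤ (toℕ x) (toℕ y)) (≤⇒≤ᵇ ∘ f-reflect {x} {y}))

  f-if : ∀ x y {u v} →
         f (if toℕ x ≤ᵇ toℕ y then u else v) ≡ (if toℕ (f x) ≤ᵇ toℕ (f y) then f u else f v)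
  f-if x y {u} {v} =
    trans (if-float f (toℕ x ≤ᵇ toℕ y)) (cong (λ c → if c then f u else f v) (sym (f-≤ᵇ x y)))

  f-min : ∀ x y → f (A.min x y) ≡ B.min (f x) (f y)
  f-min x y = f-if x y

  f-max : ∀ x y → f (A.max x y) ≡ B.max (f x) (f y)
  f-max x y = f-if x y

  f-⊛ : ∀ x y → f (x A.⊛ y) ≡ f x B.⊛ f y
  f-⊛ x y = begin
    f (x A.⊛ y)
      ≡⟨ f-if x (A.neg y) ⟩
    (if toℕ (f x) ≤ᵇ toℕ (f (A.neg y)) then f A.bot else f (A.min x y))
      ≡⟨ cong₂ (λ z u → if toℕ (f x) ≤ᵇ toℕ z then f A.bot else u) (f-neg y) (f-min x y) ⟩
    (if toℕ (f x) ≤ᵇ toℕ (B.neg (f y)) then f A.bot else B.min (f x) (f y))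
      ≡⟨ cong (λ z → if toℕ (f x) ≤ᵇ toℕ (B.neg (f y)) then z else B.min (f x) (f y)) f-bot ⟩
    f x B.⊛ f y ∎
    where open ≡-Reasoning

  f-⇛ : ∀ x y → f (x A.⇛ y) ≡ f x B.⇛ f y
  f-⇛ x y = begin
    f (x A.⇛ y)
      ≡⟨ f-if x y ⟩
    (if toℕ (f x) ≤ᵇ toℕ (f y) then f A.top else f (A.max (A.neg x) y))
      ≡⟨ cong₂ (λ t u → if toℕ (f x) ≤ᵇ toℕ (f y) then t else u) f-top (f-max (A.neg x) y) ⟩
    (if toℕ (f x) ≤ᵇ toℕ (f y) then B.top else B.max (f (A.neg x)) (f y))
      ≡⟨ cong (λ z → if toℕ (f x) ≤ᵇ toℕ (f y) then B.top else B.max z (f y)) (f-neg x) ⟩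
    f x B.⇛ f y ∎
    where open ≡-Reasoning

  -- f has a left adjoint ceil and, by the symmetry f-neg, a right adjoint
  -- floor = opposite ∘ ceil ∘ opposite; they pull infima and suprema back along f.
  private
    ceil-spec : ∀ u → Σ (Fin (suc a)) λ c → u ≤ f c × (∀ x → u ≤ f x → c ≤ x)
    ceil-spec u =
      least (λ x → u ≤ f x) (λ x → toℕ u ≤? toℕ (f x)) (subst (u ≤_) (sym f-top) (≤fromℕ u))

  ceil : Fin (suc b) → Fin (suc a)
  ceil u = proj₁ (ceil-spec u)

  ≤-ceil : ∀ u → u ≤ f (ceil u)
  ≤-ceil u = proj₁ (proj₂ (ceil-spec u))

  ceil-least : ∀ {u x} → u ≤ f x → ceil u ≤ x
  ceil-least {u} {x} = proj₂ (proj₂ (ceil-spec u)) x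

  floor : Fin (suc b) → Fin (suc a)
  floor u = opposite (ceil (opposite u))

  floor-≤ : ∀ u → f (floor u) ≤ u
  floor-≤ u = subst₂ _≤_ (sym (f-neg _)) (opposite-involutive u) (opposite-antitone (≤-ceil (opposite u)))

  floor-greatest : ∀ {u x} → f x ≤ u → x ≤ floor u
  floor-greatest {u} {x} fx≤u =
    subst (_≤ floor u) (opposite-involutive x)
      (opposite-antitone (ceil-least (subst (opposite u ≤_) (sym (f-neg x)) (opposite-antitone fx≤u))))

  IsImage : (A.Carrier → Set) → (B.Carrier → Set) → Set
  IsImage V W = (∀ {v} → V v → W (f v)) × (∀ {w} → W w → Σ A.Carrier λ v → V v × w ≡ f v)

  image-apply₂ : ∀ {_∙_ _∘_} → (∀ x y → f (x ∙ y) ≡ f x ∘ f y) →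
                 ∀ {V V′ W W′} → IsImage V V′ → IsImage W W′ →
                 IsImage (A.Apply₂ _∙_ V W) (B.Apply₂ _∘_ V′ W′)
  image-apply₂ {_∙_} {_∘_} f-hom {V} {V′} {W} {W′} (V→ , V←) (W→ , W←) = embed , reflect
    where
    embed : ∀ {v} → A.Apply₂ _∙_ V W v → B.Apply₂ _∘_ V′ W′ (f v)
    embed (x , y , Vx , Wy , refl) = f x , f y , V→ Vx , W→ Wy , f-hom x y
    reflect : ∀ {w} → B.Apply₂ _∘_ V′ W′ w → Σ A.Carrier λ v → A.Apply₂ _∙_ V W v × w ≡ f v
    reflect (x′ , y′ , V′x′ , W′y′ , refl) with V← V′x′ | W← W′y′
    ... | x , Vx , refl | y , Wy , refl = x ∙ y , (x , y , Vx , Wy , refl) , sym (f-hom x y)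

  module _ {D : Set} {V : D → A.Carrier → Set} {V′ : D → B.Carrier → Set}
           (images : ∀ d → IsImage (V d) (V′ d)) where

    image-lower : ∀ {u} → A.LowerBound V u → B.LowerBound V′ (f u)
    image-lower lb d w V′w with proj₂ (images d) V′w
    ... | v , Vv , refl = f-mono (lb d v Vv)

    image-upper : ∀ {u} → A.UpperBound V u → B.UpperBound V′ (f u)
    image-upper ub d w V′w with proj₂ (images d) V′w
    ... | v , Vv , refl = f-mono (ub d v Vv)

    image-inf : IsImage (A.IsInf V) (B.IsInf V′)
    image-inf = embed , reflect
      where
      embed : ∀ {v} → A.IsInf V v → B.IsInf V′ (f v)
      embed (lb , glb) = image-lower lb , λ u lb′ →
        ≤-trans (≤-ceil u) (f-mono (glb (ceil u) λ d w Vw → ceil-least (lb′ d (f w) (proj₁ (images d) Vw))))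
      reflect : ∀ {w} → B.IsInf V′ w → Σ A.Carrier λ v → A.IsInf V v × w ≡ f v
      reflect {w} (lb′ , glb′) = ceil w , (lb , glb) , ≤-antisym (≤-ceil w) (glb′ _ (image-lower lb))
        where
        lb : A.LowerBound V (ceil w)
        lb d v Vv = ceil-least (lb′ d (f v) (proj₁ (images d) Vv))
        glb : ∀ u → A.LowerBound V u → u ≤ ceil w
        glb u lbu = f-reflect (≤-trans (glb′ (f u) (image-lower lbu)) (≤-ceil w))

    image-sup : IsImage (A.IsSup V) (B.IsSup V′)
    image-sup = embed , reflect
      where
      embed : ∀ {v} → A.IsSup V v → B.IsSup V′ (f v)
      embed (ub , lub) = image-upper ub , λ u ub′ →
        ≤-trans (f-mono (lub (floor u) λ d w Vw → floor-greatest (ub′ d (f w) (proj₁ (images d) Vw))))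
                (floor-≤ u)
      reflect : ∀ {w} → B.IsSup V′ w → Σ A.Carrier λ v → A.IsSup V v × w ≡ f v
      reflect {w} (ub′ , lub′) = floor w , (ub , lub) , ≤-antisym (lub′ _ (image-upper ub)) (floor-≤ w)
        where
        ub : A.UpperBound V (floor w)
        ub d v Vv = floor-greatest (ub′ d (f v) (proj₁ (images d) Vv))
        lub : ∀ u → A.UpperBound V u → floor w ≤ u
        lub u ubu = f-reflect (≤-trans (floor-≤ w) (lub′ (f u) (image-upper ubu)))

  image-model : A.Model → B.Model
  image-model M = record
    { Dom = Dom ; inhabitant = inhabitant ; predI = λ k i ds → f (predI k i ds) ; constI = constI }
    where open A.Model M

  module _ (M : A.Model) where
    private
      M′ : B.Model
      M′ = image-model M

    term-image : ∀ e t → B.term M′ e t ≡ A.term M e t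
    term-image e (var x)  = refl
    term-image e (cnst c) = refl

    val-image : ∀ φ e → IsImage (A.Val M φ e) (B.Val M′ φ e)
    val-image (pred k i ts) e = (λ { refl → predI-image }) , λ { refl → _ , refl , sym predI-image }
      where
      open A.Model M
      predI-image : f (predI k i (map (A.term M e) ts)) ≡ f (predI k i (map (B.term M′ e) ts))
      predI-image = cong (f ∘ predI k i) (sym (map-cong (term-image e) ts))
    val-image (φ &ᶠ ψ) e = image-apply₂ f-⊛ (val-image φ e) (val-image ψ e)
    val-image (φ ∧ᶠ ψ) e = image-apply₂ f-min (val-image φ e) (val-image ψ e)
    val-image (φ →ᶠ ψ) e = image-apply₂ f-⇛ (val-image φ e) (val-image ψ e)
    val-image ⊥ᶠ e = (λ { refl → f-bot }) , λ { refl → zero , refl , sym f-bot }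
    val-image (∀ᶠ x φ) e = image-inf (λ d → val-image φ (A.update M e x d))
    val-image (∃ᶠ x φ) e = image-sup (λ d → val-image φ (A.update M e x d))

  taut-reflect : ∀ φ → B.Taut φ → A.Taut φ
  taut-reflect φ taut M e v Vv =
    f-injective (trans (taut (image-model M) e (f v) (proj₁ (val-image M φ e) Vv)) (sym f-top))

module ParityEmbedding (a d : ℕ) where
  open import Data.Nat using (_≤_)

  k l : ℕ
  k = suc a
  l = suc a + d + d

  jump : ℕ → ℕ → ℕ
  jump t x = if t ≤ᵇ x then d else 0

  jump-≥ : ∀ {t x} → t ≤ x → jump t x ≡ d
  jump-≥ {t} {x} t≤x with t ≤ᵇ x | ≤ᵇ-reflects-≤ t x
  ... | true  | _       = refl
  ... | false | ofⁿ t≰x = ⊥-elim (t≰x t≤x)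

  jump-< : ∀ {t x} → x < t → jump t x ≡ 0
  jump-< {t} {x} x<t with t ≤ᵇ x | ≤ᵇ-reflects-≤ t x
  ... | true  | ofʸ t≤x = ⊥-elim (<⇒≱ x<t t≤x)
  ... | false | _       = refl

  jump-mono : ∀ t {x y} → x ≤ y → jump t x ≤ jump t y
  jump-mono t {x} {y} x≤y with t ≤ᵇ x | ≤ᵇ-reflects-≤ t x | t ≤ᵇ y | ≤ᵇ-reflects-≤ t y
  ... | false | _       | _     | _       = z≤n
  ... | true  | _       | true  | _       = ≤-refl
  ... | true  | ofʸ t≤x | false | ofⁿ t≰y = ⊥-elim (t≰y (≤-trans t≤x x≤y))

  -- 0 ↦ 0, x ↦ x + d for 0 < x < k, k ↦ k + 2d: the image is symmetric under x ↦ l ∸ x,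
  -- which needs the gap l ∸ k = 2d to be even.
  g : ℕ → ℕ
  g x = x + jump 1 x + jump k x

  g-mono : ∀ {x y} → x ≤ y → g x ≤ g y
  g-mono x≤y = +-mono-≤ (+-mono-≤ x≤y (jump-mono 1 x≤y)) (jump-mono k x≤y)

  g-strict : ∀ {x y} → x < y → g x < g y
  g-strict x<y = +-mono-≤ (+-mono-≤ x<y (jump-mono 1 (<⇒≤ x<y))) (jump-mono k (<⇒≤ x<y))

  g-reflect : ∀ {x y} → g x ≤ g y → x ≤ y
  g-reflect gx≤gy = ≮⇒≥ λ y<x → <⇒≱ (g-strict y<x) gx≤gy

  g-zero : g 0 ≡ 0
  g-zero = cong₂ _+_ (jump-< {1} {0} (s≤s z≤n)) (jump-< {k} (s≤s z≤n))

  g-top : g k ≡ l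
  g-top = cong₂ (λ u v → k + u + v) (jump-≥ {1} {k} (s≤s z≤n)) (jump-≥ {k} ≤-refl)

  g-middle : ∀ {x} → 0 < x → x < k → g x ≡ x + d
  g-middle 0<x x<k = trans (cong₂ (λ u v → _ + u + v) (jump-≥ 0<x) (jump-< x<k)) (+-identityʳ _)

  g-complement : ∀ {x} → x ≤ k → g x + g (k ∸ x) ≡ l
  g-complement {zero} _ = trans (cong (_+ g k) g-zero) g-top
  g-complement {suc x} x≤k with m≤n⇒m<n∨m≡n x≤k
  ... | inj₂ refl = trans (cong₂ _+_ g-top (trans (cong g (n∸n≡0 x)) g-zero)) (+-identityʳ l)
  ... | inj₁ x<k = begin
    g (suc x) + g (k ∸ suc x)      ≡⟨ cong₂ _+_ (g-middle (s≤s z≤n) x<k)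
                                                (g-middle (m<n⇒0<n∸m x<k) (∸-monoʳ-< (s≤s z≤n) (<⇒≤ x<k))) ⟩
    (suc x + d) + (k ∸ suc x + d)  ≡⟨ +-interchange (suc x) (k ∸ suc x) d ⟩
    suc x + (k ∸ suc x) + d + d    ≡⟨ cong (λ s → s + d + d) (m+[n∸m]≡n (<⇒≤ x<k)) ⟩
    l                              ∎
    where
    open ≡-Reasoning
    +-interchange : ∀ x y d → (x + d) + (y + d) ≡ x + y + d + d
    +-interchange = solve-∀

  f : Fin (suc k) → Fin (suc l)
  f x = fromℕ< (s≤s (subst (g (toℕ x) ≤_) g-top (g-mono (toℕ≤pred[n] x))))

  toℕ-f : ∀ x → toℕ (f x) ≡ g (toℕ x)
  toℕ-f x = toℕ-fromℕ< _

  f-mono : ∀ {x y} → toℕ x ≤ toℕ y → toℕ (f x) ≤ toℕ (f y)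
  f-mono {x} {y} x≤y = subst₂ _≤_ (sym (toℕ-f x)) (sym (toℕ-f y)) (g-mono x≤y)

  f-reflect : ∀ {x y} → toℕ (f x) ≤ toℕ (f y) → toℕ x ≤ toℕ y
  f-reflect {x} {y} fx≤fy = g-reflect (subst₂ _≤_ (toℕ-f x) (toℕ-f y) fx≤fy)

  f-top : f (fromℕ k) ≡ fromℕ l
  f-top = toℕ-injective (begin
    toℕ (f (fromℕ k))  ≡⟨ toℕ-f (fromℕ k) ⟩
    g (toℕ (fromℕ k))  ≡⟨ cong g (toℕ-fromℕ k) ⟩
    g k                ≡⟨ g-top ⟩
    l                  ≡⟨ toℕ-fromℕ l ⟨
    toℕ (fromℕ l)      ∎)
    where open ≡-Reasoning

  f-neg : ∀ x → f (opposite x) ≡ opposite (f x)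
  f-neg x = toℕ-injective (begin
    toℕ (f (opposite x))  ≡⟨ toℕ-f (opposite x) ⟩
    g (toℕ (opposite x))  ≡⟨ cong g (opposite-prop x) ⟩
    g (k ∸ toℕ x)         ≡⟨ m+n∸m≡n (g (toℕ x)) _ ⟨
    g (toℕ x) + g (k ∸ toℕ x) ∸ g (toℕ x) ≡⟨ cong (_∸ g (toℕ x)) (g-complement (toℕ≤pred[n] x)) ⟩
    l ∸ g (toℕ x)         ≡⟨ cong (l ∸_) (toℕ-f x) ⟨
    l ∸ toℕ (f x)         ≡⟨ opposite-prop (f x) ⟨
    toℕ (opposite (f x))  ∎)
    where open ≡-Reasoning

  open Embedding f f-mono f-reflect f-top f-neg public using (taut-reflect)

Descending : (ℕ → ℕ) → ℕ → ℕ → Set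
Descending q zero    i = q (suc i) < q i
Descending q (suc r) i = q (suc i) < q i × Descending q r (suc i)

descending⇒< : ∀ {q} r i → Descending q r i → r < q i
descending⇒< zero    i q₁<q₀         = ≤-trans (s≤s z≤n) q₁<q₀
descending⇒< (suc r) i (q₁<q₀ , dq) = ≤-trans (s≤s (descending⇒< r (suc i) dq)) q₁<q₀

descending-from : ∀ {q k} → (∀ i → i < k → q (suc i) < q i) → ∀ r i → i + r < k → Descending q r i
descending-from {k = k} step zero    i i+0<k  = step i (subst (_< k) (+-identityʳ i) i+0<k)
descending-from {k = k} step (suc r) i i+r+1<k =
  step i (≤-trans (s≤s (m≤m+n i (suc r))) i+r+1<k) ,
  descending-from step r (suc i) (subst (_< k) (+-suc i r) i+r+1<k)

atomᶠ : ℕ → Fm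
atomᶠ i = pred 0 i []

_∨ᶠ_ : Fm → Fm → Fm
φ ∨ᶠ ψ = ((φ →ᶠ ψ) →ᶠ ψ) ∧ᶠ ((ψ →ᶠ φ) →ᶠ φ)

stepᶠ : ℕ → Fm
stepᶠ i = atomᶠ i →ᶠ atomᶠ (suc i)

ascentᶠ : ℕ → ℕ → Fm
ascentᶠ zero    i = stepᶠ i
ascentᶠ (suc r) i = stepᶠ i ∨ᶠ ascentᶠ r (suc i)

module Ascent (j : ℕ) where
  open NMChain j

  ascent : (ℕ → Carrier) → ℕ → ℕ → Carrier
  ascent p zero    i = p i ⇛ p (suc i)
  ascent p (suc r) i = (p i ⇛ p (suc i)) ∨ ascent p r (suc i)

  ascent≡top⊎descending : ∀ p r i → ascent p r i ≡ top ⊎ Descending (toℕ ∘ p) r i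
  ascent≡top⊎descending p zero i = ⇛≡top⊎> (p i) (p (suc i))
  ascent≡top⊎descending p (suc r) i with ⇛≡top⊎> (p i) (p (suc i)) | ascent≡top⊎descending p r (suc i)
  ... | inj₁ step≡top | _             = inj₁ (trans (cong (_∨ ascent p r (suc i)) step≡top) (∨-topˡ _))
  ... | inj₂ _        | inj₁ rest≡top =
    inj₁ (trans (cong ((p i ⇛ p (suc i)) ∨_) rest≡top) (∨-topʳ (p i ⇛ p (suc i))))
  ... | inj₂ p₁<p₀    | inj₂ dp       = inj₂ (p₁<p₀ , dp)

  descending⇒ascent≢top : ∀ p r i → Descending (toℕ ∘ p) r i → ascent p r i ≢ top
  descending⇒ascent≢top p zero i p₁<p₀ eq = <⇒≱ p₁<p₀ (⇛≡top⇒≤ eq)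
  descending⇒ascent≢top p (suc r) i (p₁<p₀ , dp) eq with ∨≡top⇒ eq
  ... | inj₁ step≡top = descending⇒ascent≢top p zero i p₁<p₀ step≡top
  ... | inj₂ rest≡top = descending⇒ascent≢top p r (suc i) dp rest≡top

  module _ (M : Model) (e : Eval M) where
    open Model M

    atoms : ℕ → Carrier
    atoms i = predI 0 i []

    val-∨ᶠ : ∀ {φ ψ x y} → Val M φ e x → Val M ψ e y → Val M (φ ∨ᶠ ψ) e (x ∨ y)
    val-∨ᶠ Vx Vy = _ , _ , (_ , _ , (_ , _ , Vx , Vy , refl) , Vy , refl)
                         , (_ , _ , (_ , _ , Vy , Vx , refl) , Vx , refl) , refl

    val-ascent : ∀ r i → Val M (ascentᶠ r i) e (ascent atoms r i)
    val-ascent zero    i = _ , _ , refl , refl , refl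
    val-ascent (suc r) i = val-∨ᶠ {stepᶠ i} {ascentᶠ r (suc i)} (val-ascent zero i) (val-ascent r (suc i))

  ascent-taut : Taut (ascentᶠ j 0)
  ascent-taut M e v Vv with ascent≡top⊎descending (atoms M e) j 0
  ... | inj₁ ascent≡top = trans (val-unique M (ascentᶠ j 0) e Vv (val-ascent M e j 0)) ascent≡top
  ... | inj₂ dp = ⊥-elim (<⇒≱ (descending⇒< j 0 dp) (toℕ≤pred[n] (atoms M e 0)))

  countdown : ℕ → Carrier
  countdown i = fromℕ< (s≤s (m∸n≤m j i))

  countdown-model : Model
  countdown-model = record { Dom = ⊤ ; inhabitant = tt ; predI = λ _ i _ → countdown i ; constI = λ _ → tt }

  ascent-not-taut : ∀ {r} → r < j → ¬ Taut (ascentᶠ r 0)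
  ascent-not-taut {r} r<j taut =
    descending⇒ascent≢top countdown r 0 (descending-from countdown-step r 0 r<j)
      (taut countdown-model (λ _ → tt) _ (val-ascent countdown-model (λ _ → tt) r 0))
    where
    countdown-step : ∀ i → i < j → toℕ (countdown (suc i)) < toℕ (countdown i)
    countdown-step i i<j =
      subst₂ _<_ (sym (toℕ-fromℕ< (s≤s (m∸n≤m j (suc i))))) (sym (toℕ-fromℕ< (s≤s (m∸n≤m j i))))
                 (∸-monoʳ-< (n<1+n i) i<j)

even-gap : ∀ {m n} → m ℕ.≤ n → m % 2 ≡ n % 2 → ∃[ d ] n ≡ m + d + d
even-gap {m} {n} m≤n same-parity = d , (begin
  n                          ≡⟨ m≡m%n+[m/n]*n n 2 ⟩
  n % 2 + n / 2 * 2          ≡⟨ cong₂ (λ r h → r + h * 2) (sym same-parity) (sym (m+[n∸m]≡n (/-monoˡ-≤ 2 m≤n))) ⟩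
  m % 2 + (m / 2 + d) * 2    ≡⟨ distribute (m % 2) (m / 2) d ⟩
  m % 2 + m / 2 * 2 + d + d  ≡⟨ cong (λ x → x + d + d) (m≡m%n+[m/n]*n m 2) ⟨
  m + d + d                  ∎)
  where
  open ≡-Reasoning
  d : ℕ
  d = n / 2 ∸ m / 2
  distribute : ∀ r h d → r + (h + d) * 2 ≡ r + h * 2 + d + d
  distribute = solve-∀

mainTheorem13 : (m n : ℕ) → 1 < m → m < n → m % 2 ≡ n % 2 →
                TAUT n ⊂ TAUT m
mainTheorem13 (suc (suc a)) (suc b) (s≤s (s≤s _)) (s≤s a+1<b) same-parity
  with even-gap (<⇒≤ (s≤s a+1<b)) same-parity
... | d , refl =
  ParityEmbedding.taut-reflect a d ,
  ascentᶠ (suc a) 0 , Ascent.ascent-taut (suc a) , Ascent.ascent-not-taut (suc a + d + d) a+1<b
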